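{- Let $(X,\theta)$ be a commutation alphabet and $R\subseteq X\times\mathcal{S}(X,\theta)$ such that the alphabetic rewriting system $(\mathcal{S}(X,\theta),\Rightarrow_R)$ is convergent. Then the set $\mathsf{Irr}(\mathcal{S}(X,\theta),\Rightarrow_R)$ of irreducible elements is equal (as a sub-semigroup of $\mathcal{S}(X,\theta)$) to the free partially commutative semigroup $\mathcal{S}(\mathsf{Irr}(X),\theta_{\mathsf{Irr}(X)})$, where $\mathsf{Irr}(X)=\mathsf{Irr}(\mathcal{S}(X,\theta),\Rightarrow_R)\cap X$ and $\theta_{\mathsf{Irr}(X)}=\theta\cap(\mathsf{Irr}(X)\times\mathsf{Irr}(X))$.
   Context: A commutation alphabet is a pair $(X,\theta)$ with $\theta\subseteq X\times X$ symmetric and irreflexive. $\equiv_\theta$ is the congruence on $X^+$ (resp. $X^*$) generated by $(xy,yx)$ for $(x,y)\in\theta$; $\mathcal{S}(X,\theta)=X^+/\equiv_\theta$ and $\mathcal{M}(X,\theta)=X^*/\equiv_\theta=\mathcal{S}(X,\theta)\cup\{\epsilon\}$; $X$ is identified with its image in $\mathcal{S}(X,\theta)$, and for $Y\subseteq X$, $\mathcal{S}(Y,\theta\cap(Y\times Y))$ is identified with the sub-semigroup of $\mathcal{S}(X,\theta)$ generated by $Y$ (the natural map is injective). $w\Rightarrow_R w'$ iff $w=uav$, $w'=ubv$ for some $u,v\in\mathcal{M}(X,\theta)$, $(a,b)\in R$. Convergent means terminating (no infinite chain $w_0\Rightarrow_R w_1\Rightarrow_R\cdots$) and confluent (any two elements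 reachable by $\xRightarrow{*}$ from a common element have a common $\xRightarrow{*}$-descendant). An element $w$ is irreducible if there is no $w'$ with $w\Rightarrow_R w'$. -}

module Defs where

open import Level using (Level; _⊔_; suc)
open import Data.Nat using (ℕ) renaming (suc to sucℕ)
open import Data.List using (List; []; _∷_; _++_)
open import Data.List.NonEmpty as L⁺ using (List⁺; toList)
open import Data.Product using (Σ; ∃; ∃-syntax; _×_; _,_; proj₁)
open import Data.Sum using (_⊎_)
open import Relation.Nullary using (¬_)
open import Relation.Binary.Construct.Closure.ReflexiveTransitive using (Star)

record CommutationAlphabet (a ℓ : Level) : Set (suc (a ⊔ ℓ)) where
  field
    X      : Set a
    θ      : X → X → Set ℓ
    θ-sym  : ∀ {x y} → θ x y → θ y x
    θ-irr  : ∀ {x} → ¬ θ x x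

module Traces {a ℓ : Level} (A : CommutationAlphabet a ℓ) where
  open CommutationAlphabet A

  -- Elements of M(X,θ) are represented by List X, elements of S(X,θ)
  -- by List⁺ X, both up to ≡θ (setoid presentation of the quotients).
  data _≡θ_ : List X → List X → Set (a ⊔ ℓ) where
    ≡θ-refl  : ∀ {u} → u ≡θ u
    ≡θ-sym   : ∀ {u v} → u ≡θ v → v ≡θ u
    ≡θ-trans : ∀ {u v w} → u ≡θ v → v ≡θ w → u ≡θ w
    ≡θ-swap  : ∀ u v {x y} → θ x y → (u ++ x ∷ y ∷ v) ≡θ (u ++ y ∷ x ∷ v)

  _≈S_ : List⁺ X → List⁺ X → Set (a ⊔ ℓ)
  w ≈S w' = toList w ≡θ toList w'

  module Rewriting {r : Level} (R : X → List⁺ X → Set r) where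
    _⇒_ : List⁺ X → List⁺ X → Set (a ⊔ ℓ ⊔ r)
    w ⇒ w' = Σ (List X) λ u → Σ (List X) λ v → Σ X λ x → Σ (List⁺ X) λ b →
               R x b × (toList w ≡θ (u ++ x ∷ v)) × (toList w' ≡θ (u ++ toList b ++ v))

    _⇒*_ : List⁺ X → List⁺ X → Set (a ⊔ ℓ ⊔ r)
    _⇒*_ = Star (λ w w' → w ≈S w' ⊎ w ⇒ w')

    Terminating : Set (a ⊔ ℓ ⊔ r)
    Terminating = ¬ (Σ (ℕ → List⁺ X) λ f → ∀ n → f n ⇒ f (sucℕ n))

    Confluent : Set (a ⊔ ℓ ⊔ r)
    Confluent = ∀ w w₁ w₂ → w ⇒* w₁ → w ⇒* w₂ → ∃[ w₃ ] (w₁ ⇒* w₃ × w₂ ⇒* w₃)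

    Convergent : Set (a ⊔ ℓ ⊔ r)
    Convergent = Terminating × Confluent

    Irreducible : List⁺ X → Set (a ⊔ ℓ ⊔ r)
    Irreducible w = ¬ (∃[ w' ] (w ⇒ w'))

    IrrX : Set (a ⊔ ℓ ⊔ r)
    IrrX = Σ X λ x → Irreducible (L⁺.[ x ])

    -- w lies in the image of S(Irr(X), θ_Irr(X)) → S(X,θ), i.e. in the
    -- sub-semigroup generated by Irr(X).
    InSubsemigroupIrrX : List⁺ X → Set (a ⊔ ℓ ⊔ r)
    InSubsemigroupIrrX w = Σ (List⁺ IrrX) λ w' → w ≈S L⁺.map proj₁ w'

module Submission where

open import Defs
open import Level using (Level; _⊔_)
open import Data.List.NonEmpty using (List⁺)
open import Function.Bundles using (_⇔_)
open import Function.Bundles using (mk⇔; module Equivalence)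
open import Function.Properties.Equivalence as ⇔ using ()
open import Data.List.NonEmpty as L⁺ using (_∷_; toList; _⁺++_)
open import Data.List as List using (List; []; _∷_; _++_)
open import Data.List.Relation.Unary.All as All using (All; []; _∷_)
open import Data.List.Relation.Unary.All.Properties using (map⁺)
open import Data.List.Membership.Propositional.Properties using (∈-∃++; ∈-insert)
open import Data.List.Relation.Binary.Permutation.Propositional
  using (_↭_; ↭-refl; ↭-sym; ↭-trans; ↭-swap)
open import Data.List.Relation.Binary.Permutation.Propositional.Properties
  using (All-resp-↭; ++⁺ˡ)
open import Data.Product using (_,_; proj₁)
open import Relation.Nullary using (¬_)
open import Relation.Binary.PropositionalEquality using (_≡_; refl; sym; cong)

-- The rewriting system is alphabetic: a step w ⇒ w' replaces ONE occurrence
-- of a letter x by some b with (x , b) ∈ R.  Hence whether w is irreducible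
-- depends only on the letters of w: w is irreducible iff none of its letters
-- is the left-hand side of a rule ("terminal" letter).  Specialised to a
-- single letter this says Irr(X) is exactly the set of terminal letters, so
-- both sides of the theorem are equivalent to "every letter of w is terminal".

map-proj₁-toList : ∀ {a p} {X : Set a} {P : X → Set p} {xs : List X}
                   (pxs : All P xs) → List.map proj₁ (All.toList pxs) ≡ xs
map-proj₁-toList []         = refl
map-proj₁-toList (px ∷ pxs) = cong (_ ∷_) (map-proj₁-toList pxs)

module _ {a ℓ : Level} (A : CommutationAlphabet a ℓ) where
  open CommutationAlphabet A
  open Traces A

  ≡⇒≡θ : ∀ {u v} → u ≡ v → u ≡θ v
  ≡⇒≡θ refl = ≡θ-refl

  ≡θ⇒↭ : ∀ {u v} → u ≡θ v → u ↭ v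
  ≡θ⇒↭ ≡θ-refl                 = ↭-refl
  ≡θ⇒↭ (≡θ-sym e)              = ↭-sym (≡θ⇒↭ e)
  ≡θ⇒↭ (≡θ-trans e f)          = ↭-trans (≡θ⇒↭ e) (≡θ⇒↭ f)
  ≡θ⇒↭ (≡θ-swap u v {x} {y} _) = ++⁺ˡ u (↭-swap x y ↭-refl)

  All-resp-≡θ : ∀ {p} {P : X → Set p} {u v} → u ≡θ v → All P u → All P v
  All-resp-≡θ e = All-resp-↭ (≡θ⇒↭ e)

  module _ {r : Level} (R : X → List⁺ X → Set r) where
    open Rewriting R

    Terminal : X → Set (a ⊔ r)
    Terminal x = ∀ b → ¬ R x b

    splice : List X → List⁺ X → List X → List⁺ X
    splice []      b v = b ⁺++ v
    splice (z ∷ u) b v = z ∷ (u ++ toList b ++ v)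

    rewriteAt : ∀ {w} u v {x b} → R x b → toList w ≡ u ++ x ∷ v → w ⇒ splice u b v
    rewriteAt u v {x} {b} rxb w≡uxv =
      u , v , x , b , rxb , ≡⇒≡θ w≡uxv , ≡⇒≡θ (toList-splice u)
      where
      toList-splice : ∀ u → toList (splice u b v) ≡ u ++ toList b ++ v
      toList-splice []      = refl
      toList-splice (_ ∷ _) = refl

    irreducible⇔allTerminal : ∀ w → Irreducible w ⇔ All Terminal (toList w)
    irreducible⇔allTerminal w = mk⇔ lettersTerminal noStep
      where
      lettersTerminal : Irreducible w → All Terminal (toList w)
      lettersTerminal irr = All.tabulate λ x∈w b rxb →
        let (u , v , w≡uxv) = ∈-∃++ x∈w in irr (_ , rewriteAt u v rxb w≡uxv)

      noStep : All Terminal (toList w) → Irreducible w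
      noStep terminal (_ , u , v , x , b , rxb , w≡uxv , _) =
        All.lookup (All-resp-≡θ w≡uxv terminal) (∈-insert u) b rxb

    irreducibleLetter⇔terminal : ∀ x → Irreducible L⁺.[ x ] ⇔ Terminal x
    irreducibleLetter⇔terminal x =
      mk⇔ (λ irr → All.head (Equivalence.to (irreducible⇔allTerminal L⁺.[ x ]) irr))
          (λ t → Equivalence.from (irreducible⇔allTerminal L⁺.[ x ]) (t ∷ []))

    inSubsemigroup⇔allTerminal : ∀ w → InSubsemigroupIrrX w ⇔ All Terminal (toList w)
    inSubsemigroup⇔allTerminal w = mk⇔ lettersTerminal (generated w)
      where
      irr⇒terminal : ∀ x → Irreducible L⁺.[ x ] → Terminal x
      irr⇒terminal x = Equivalence.to (irreducibleLetter⇔terminal x)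

      terminal⇒irr : ∀ x → Terminal x → Irreducible L⁺.[ x ]
      terminal⇒irr x = Equivalence.from (irreducibleLetter⇔terminal x)

      lettersTerminal : InSubsemigroupIrrX w → All Terminal (toList w)
      lettersTerminal (p ∷ ps , w≈w') =
        All-resp-≡θ (≡θ-sym w≈w')
          (map⁺ (All.universal (λ (x , irr) → irr⇒terminal x irr) (p ∷ ps)))

      generated : ∀ w → All Terminal (toList w) → InSubsemigroupIrrX w
      generated (x ∷ xs) (t ∷ ts) =
        (x , terminal⇒irr x t) ∷ All.toList irrs ,
        ≡⇒≡θ (cong (x ∷_) (sym (map-proj₁-toList irrs)))
        where
        irrs : All (λ y → Irreducible L⁺.[ y ]) xs
        irrs = All.map (terminal⇒irr _) ts

mainTheorem2 : ∀ {a ℓ r : Level} (A : CommutationAlphabet a ℓ)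
    (R : CommutationAlphabet.X A → List⁺ (CommutationAlphabet.X A) → Set r) →
    Traces.Rewriting.Convergent A R →
    ∀ (w : List⁺ (CommutationAlphabet.X A)) →
    Traces.Rewriting.Irreducible A R w ⇔ Traces.Rewriting.InSubsemigroupIrrX A R w
mainTheorem2 A R _ w =
  ⇔.trans (irreducible⇔allTerminal A R w) (⇔.sym (inSubsemigroup⇔allTerminal A R w))
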